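{- Let $m\ge 2$ be an integer with $\omega(m)=4$. Then either $m$ is odd and every divisor $d>1$ of $m$ satisfies $\omega(d)=4$, or $m=2n$ where $n$ is odd and every divisor $d>1$ of $n$ satisfies $\omega(d)=4$.
   Context: $F_n$ denotes the Fibonacci sequence: $F_0=0$, $F_1=1$, $F_n=F_{n-1}+F_{n-2}$. For an integer $m\ge 2$, the Pisano period $\pi(m)$ is the least positive period of $(F_n \bmod m)$, and $\omega(m)$ is the number of indices $0\le n<\pi(m)$ with $m\mid F_n$. -}

module Defs where

open import Data.Nat using (ℕ; zero; suc; _+_; _<_; _≤_; _%_; NonZero)
open import Data.Nat.Divisibility using (_∣_; _∣?_)
open import Data.List using (List; length; filter; upTo)
open import Data.Product using (Σ; _×_)
open import Relation.Binary.PropositionalEquality using (_≡_)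

fib : ℕ → ℕ
fib zero = zero
fib (suc zero) = suc zero
fib (suc (suc n)) = fib (suc n) + fib n

IsPeriod : (m p : ℕ) → .{{NonZero m}} → Set
IsPeriod m p = 0 < p × (∀ n → fib (n + p) % m ≡ fib n % m)

IsPisano : (m p : ℕ) → .{{NonZero m}} → Set
IsPisano m p = IsPeriod m p × (∀ q → IsPeriod m q → p ≤ q)

zeroCount : (m p : ℕ) → ℕ
zeroCount m p = length (filter (λ n → m ∣? fib n) (upTo p))

Omega : (m k : ℕ) → .{{NonZero m}} → Set
Omega m k = Σ ℕ (λ p → IsPisano m p × zeroCount m p ≡ k)

{-# OPTIONS --safe #-}
-- Let a be the rank of apparition of d (the least a > 0 with d ∣ F a) and c = F (a - 1).
-- Since F (a + k) = F a F (k + 1) + c F k ≡ c F k (mod d) and gcd (c , F a) = 1, the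
-- zeros of F mod d are exactly the multiples of a, π(d) = a · ord(c) and ω(d) = ord(c).
-- Cassini's identity at a - 1 gives c² ≡ (-1)^a (mod d).  So ω(d) ≤ 2 when a is even,
-- while for odd a and d > 2 the unit c has order 4.  Hence ω(m) = 4 forces the rank of m
-- to be odd; the rank of a divisor of m divides it, so every odd divisor d > 1 of m has
-- ω(d) = 4, and 4 ∤ m because the rank of 4 is 6.
module Submission where

open import Defs
open import Data.Nat using (ℕ; zero; suc; _+_; _*_; _^_; _≤_; _<_; _≤?_; _<?_; _%_; _/_; z≤n; s≤s; NonZero)
open import Data.Nat.Properties
  using (+-identityʳ; +-comm; +-assoc; +-suc; *-identityˡ; *-identityʳ; *-zeroʳ; *-assoc; *-comm;
         suc-injective; m<1+n⇒m<n∨m≡n; n<1+n; <-trans; ≤∧≢⇒<; <⇒≱; 0≢1+n;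
         *-monoˡ-≤; *-cancelʳ-≤; *-cancelʳ-<)
open import Data.Nat.Divisibility
  using (_∣_; _∣?_; divides; ∣-trans; ∣-reflexive; ∣⇒≤; *-monoˡ-∣; m%n≡0⇒n∣m; n∣m⇒m%n≡0)
open import Data.Nat.DivMod using (%-distribˡ-+; %-distribˡ-*; m≡m%n+[m/n]*n; m%n<n; m*n%n≡0)
open import Data.Nat.Coprimality using (Coprime; coprime-divisor; coprime-+; 1-coprimeTo)
import Data.Nat.Coprimality as Coprime
open import Data.Nat.Tactic.RingSolver using (solve-∀; solve)
open import Data.List using ([]; _∷_; [_]; _++_; filter; length; upTo)
open import Data.List.Properties using (applyUpTo-∷ʳ; filter-++; length-++; filter-accept; filter-reject)
open import Data.Product using (Σ; ∃; _×_; _,_; proj₁)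
open import Data.Sum using (_⊎_; inj₁; inj₂; [_,_]′)
open import Function using (id; _∘_)
open import Level using (0ℓ)
open import Relation.Binary.Bundles using (Setoid)
open import Relation.Binary.PropositionalEquality
  using (_≡_; refl; sym; trans; cong; cong₂; subst; module ≡-Reasoning)
import Relation.Binary.Reasoning.Setoid as SetoidReasoning
open import Relation.Nullary using (¬_; yes; no; contradiction; _×-dec_)
open import Relation.Nullary.Decidable using (from-no)
open import Relation.Unary using (Decidable)

fib-+ : ∀ m n → fib (suc m + n) ≡ fib (suc m) * fib (suc n) + fib m * fib n
fib-+ zero n = sym (trans (+-identityʳ _) (*-identityˡ _))
fib-+ (suc m) n = begin
  fib (suc (suc m) + n)                                      ≡⟨ cong fib (+-suc (suc m) n) ⟨
  fib (suc m + suc n)                                        ≡⟨ fib-+ m (suc n) ⟩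
  fib (suc m) * (fib (suc n) + fib n) + fib m * fib (suc n)  ≡⟨ regroup (fib (suc m)) (fib m) _ _ ⟩
  (fib (suc m) + fib m) * fib (suc n) + fib (suc m) * fib n  ∎
  where
  open ≡-Reasoning
  regroup : ∀ x y u v → x * (u + v) + y * u ≡ (x + y) * u + x * v
  regroup = solve-∀

cassini-even⇒odd : ∀ x y → x * (y + x) + 1 ≡ y * y → y * ((y + x) + y) ≡ (y + x) * (y + x) + 1
cassini-even⇒odd x y cassini = begin
  y * ((y + x) + y)                ≡⟨ solve (x ∷ y ∷ []) ⟩
  y * (y + x) + y * y              ≡⟨ cong (y * (y + x) +_) cassini ⟨
  y * (y + x) + (x * (y + x) + 1)  ≡⟨ solve (x ∷ y ∷ []) ⟩
  (y + x) * (y + x) + 1            ∎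
  where open ≡-Reasoning

cassini-odd⇒even : ∀ x y → x * (y + x) ≡ y * y + 1 → y * ((y + x) + y) + 1 ≡ (y + x) * (y + x)
cassini-odd⇒even x y cassini = begin
  y * ((y + x) + y) + 1          ≡⟨ solve (x ∷ y ∷ []) ⟩
  y * (y + x) + (y * y + 1)      ≡⟨ cong (y * (y + x) +_) cassini ⟨
  y * (y + x) + x * (y + x)      ≡⟨ solve (x ∷ y ∷ []) ⟩
  (y + x) * (y + x)              ∎
  where open ≡-Reasoning

cassini-even : ∀ k → fib (k * 2) * fib (2 + k * 2) + 1 ≡ fib (1 + k * 2) * fib (1 + k * 2)
cassini-odd  : ∀ k → fib (1 + k * 2) * fib (3 + k * 2) ≡ fib (2 + k * 2) * fib (2 + k * 2) + 1

cassini-even zero    = refl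
cassini-even (suc k) = cassini-odd⇒even (fib (1 + k * 2)) (fib (2 + k * 2)) (cassini-odd k)
cassini-odd  k       = cassini-even⇒odd (fib (k * 2)) (fib (1 + k * 2)) (cassini-even k)

coprime-fib-suc : ∀ n → Coprime (fib n) (fib (suc n))
coprime-fib-suc zero    = Coprime.sym (1-coprimeTo 0)
coprime-fib-suc (suc n) = Coprime.sym (coprime-+ (coprime-fib-suc n))

coprime-^-divisor : ∀ {m n o} → Coprime m n → ∀ k → m ∣ n ^ k * o → m ∣ o
coprime-^-divisor {m} {o = o} coprime zero    m∣o = subst (m ∣_) (*-identityˡ o) m∣o
coprime-^-divisor {m} {n} {o} coprime (suc k) m∣n^k*o =
  coprime-^-divisor coprime k (coprime-divisor coprime (subst (m ∣_) (*-assoc n (n ^ k) o) m∣n^k*o))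

even-or-odd : ∀ n → (∃ λ k → n ≡ k * 2) ⊎ (∃ λ k → n ≡ suc (k * 2))
even-or-odd zero = inj₁ (0 , refl)
even-or-odd (suc n) with even-or-odd n
... | inj₁ (k , n≡2k)   = inj₂ (k , cong suc n≡2k)
... | inj₂ (k , n≡2k+1) = inj₁ (suc k , cong suc n≡2k+1)

least-witness : ∀ {P : ℕ → Set} → Decidable P → ∀ {n} → P n →
                ∃ λ m → P m × (∀ {k} → k < m → ¬ P k)
least-witness {P} P? {n} Pn = [ (λ none → contradiction Pn (none (n<1+n n))) , id ]′ (search (suc n))
  where
  search : ∀ b → (∀ {k} → k < b → ¬ P k) ⊎ (∃ λ m → P m × (∀ {k} → k < m → ¬ P k))
  search zero = inj₁ λ ()
  search (suc b) with search b | P? b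
  ... | inj₂ least | _      = inj₂ least
  ... | inj₁ none  | yes Pb = inj₂ (b , Pb , none)
  ... | inj₁ none  | no ¬Pb = inj₁ λ k<1+b → [ none , (λ { refl → ¬Pb }) ]′ (m<1+n⇒m<n∨m≡n k<1+b)

module _ (d : ℕ) .{{_ : NonZero d}} where

  -- A record rather than an abbreviation of x % d ≡ y % d, so that x and y can be inferred.
  infix 4 _≈_
  record _≈_ (x y : ℕ) : Set where
    constructor mod-≡
    field %-≡ : x % d ≡ y % d
  open _≈_ public

  ≈-setoid : Setoid 0ℓ 0ℓ
  ≈-setoid = record
    { Carrier       = ℕ
    ; _≈_           = _≈_
    ; isEquivalence = record
      { refl  = mod-≡ refl
      ; sym   = λ (mod-≡ x≈y) → mod-≡ (sym x≈y)
      ; trans = λ (mod-≡ x≈y) (mod-≡ y≈z) → mod-≡ (trans x≈y y≈z)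
      }
    }

  open Setoid ≈-setoid public
    using () renaming (refl to ≈-refl; sym to ≈-sym; trans to ≈-trans; reflexive to ≈-reflexive)
  private module ≈-Reasoning = SetoidReasoning ≈-setoid

  +-cong : ∀ {x x′ y y′} → x ≈ x′ → y ≈ y′ → x + y ≈ x′ + y′
  +-cong {x} {x′} {y} {y′} (mod-≡ x≈x′) (mod-≡ y≈y′) = mod-≡ (begin
    (x + y) % d              ≡⟨ %-distribˡ-+ x y d ⟩
    (x % d + y % d) % d      ≡⟨ cong₂ (λ u v → (u + v) % d) x≈x′ y≈y′ ⟩
    (x′ % d + y′ % d) % d    ≡⟨ %-distribˡ-+ x′ y′ d ⟨
    (x′ + y′) % d            ∎)
    where open ≡-Reasoning

  *-cong : ∀ {x x′ y y′} → x ≈ x′ → y ≈ y′ → x * y ≈ x′ * y′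
  *-cong {x} {x′} {y} {y′} (mod-≡ x≈x′) (mod-≡ y≈y′) = mod-≡ (begin
    (x * y) % d              ≡⟨ %-distribˡ-* x y d ⟩
    (x % d * (y % d)) % d    ≡⟨ cong₂ (λ u v → (u * v) % d) x≈x′ y≈y′ ⟩
    (x′ % d * (y′ % d)) % d  ≡⟨ %-distribˡ-* x′ y′ d ⟨
    (x′ * y′) % d            ∎)
    where open ≡-Reasoning

  private
    0%d≡0 : 0 % d ≡ 0
    0%d≡0 = m*n%n≡0 0 d

  ∣⇒≈0 : ∀ {x} → d ∣ x → x ≈ 0
  ∣⇒≈0 {x} d∣x = mod-≡ (trans (n∣m⇒m%n≡0 x d d∣x) (sym 0%d≡0))

  ≈0⇒∣ : ∀ {x} → x ≈ 0 → d ∣ x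
  ≈0⇒∣ {x} (mod-≡ x%d≡0%d) = m%n≡0⇒n∣m x d (trans x%d≡0%d 0%d≡0)

  ≈-∣ : ∀ {x y} → x ≈ y → d ∣ x → d ∣ y
  ≈-∣ x≈y d∣x = ≈0⇒∣ (≈-trans (≈-sym x≈y) (∣⇒≈0 d∣x))

  square≈1 : ∀ {x} → x + 1 ≈ 0 → x * x ≈ 1
  square≈1 {x} x+1≈0 = begin
    x * x               ≡⟨ +-identityʳ (x * x) ⟨
    x * x + 0           ≈⟨ +-cong (≈-refl {x * x}) x+1≈0 ⟨
    x * x + (x + 1)     ≡⟨ solve (x ∷ []) ⟩
    x * (x + 1) + 1     ≈⟨ +-cong (*-cong (≈-refl {x}) x+1≈0) (≈-refl {1}) ⟩
    x * 0 + 1           ≡⟨ cong (_+ 1) (*-zeroʳ x) ⟩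
    1                   ∎
    where open ≈-Reasoning

  private
    ∣fib? : Decidable (λ n → d ∣ fib n)
    ∣fib? n = d ∣? fib n

  zeroCount-suc : ∀ n → zeroCount d (suc n) ≡ zeroCount d n + length (filter ∣fib? [ n ])
  zeroCount-suc n = begin
    length (filter ∣fib? (upTo (suc n)))                 ≡⟨ cong (length ∘ filter ∣fib?) (applyUpTo-∷ʳ id n) ⟨
    length (filter ∣fib? (upTo n ++ [ n ]))              ≡⟨ cong length (filter-++ ∣fib? (upTo n) [ n ]) ⟩
    length (filter ∣fib? (upTo n) ++ filter ∣fib? [ n ]) ≡⟨ length-++ (filter ∣fib? (upTo n)) ⟩
    zeroCount d n + length (filter ∣fib? [ n ])          ∎
    where open ≡-Reasoning

  zeroCount-suc-∣ : ∀ {n} → d ∣ fib n → zeroCount d (suc n) ≡ suc (zeroCount d n)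
  zeroCount-suc-∣ {n} d∣Fn = begin
    zeroCount d (suc n)                          ≡⟨ zeroCount-suc n ⟩
    zeroCount d n + length (filter ∣fib? [ n ])  ≡⟨ cong ((zeroCount d n +_) ∘ length) (filter-accept ∣fib? d∣Fn) ⟩
    zeroCount d n + 1                            ≡⟨ +-comm (zeroCount d n) 1 ⟩
    suc (zeroCount d n)                          ∎
    where open ≡-Reasoning

  zeroCount-suc-∤ : ∀ {n} → ¬ d ∣ fib n → zeroCount d (suc n) ≡ zeroCount d n
  zeroCount-suc-∤ {n} d∤Fn = begin
    zeroCount d (suc n)                          ≡⟨ zeroCount-suc n ⟩
    zeroCount d n + length (filter ∣fib? [ n ])  ≡⟨ cong ((zeroCount d n +_) ∘ length) (filter-reject ∣fib? d∤Fn) ⟩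
    zeroCount d n + 0                            ≡⟨ +-identityʳ (zeroCount d n) ⟩
    zeroCount d n                                ∎
    where open ≡-Reasoning

  period⇒∣fib : ∀ {p} → IsPeriod d p → d ∣ fib p
  period⇒∣fib (_ , periodic) = ≈0⇒∣ (mod-≡ (periodic 0))

  record IsRank (a : ℕ) : Set where
    field
      ∣fib-rank  : d ∣ fib a
      rank-least : ∀ {r} → r < a → d ∣ fib r → r ≡ 0

  rank-exists : ∀ {n} → 0 < n → d ∣ fib n → ∃ λ a′ → IsRank (suc a′)
  rank-exists 0<n d∣Fn with least-witness (λ k → (0 <? k) ×-dec (d ∣? fib k)) (0<n , d∣Fn)
  ... | suc a′ , (_ , d∣Fa) , below = a′ , record { ∣fib-rank = d∣Fa ; rank-least = least }
    where
    least : ∀ {r} → r < suc a′ → d ∣ fib r → r ≡ 0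
    least {zero}  _   _     = refl
    least {suc r} r<a d∣Fr = contradiction (s≤s z≤n , d∣Fr) (below r<a)

  module Rank {a′ : ℕ} (rank : IsRank (suc a′)) where
    open IsRank rank

    a c : ℕ
    a = suc a′
    c = fib a′

    fib-rank≈0 : fib a ≈ 0
    fib-rank≈0 = ∣⇒≈0 ∣fib-rank

    fib-rank-+ : ∀ k → fib (a + k) ≈ c * fib k
    fib-rank-+ k = begin
      fib (a + k)                      ≡⟨ fib-+ a′ k ⟩
      fib a * fib (suc k) + c * fib k  ≈⟨ +-cong (*-cong fib-rank≈0 (≈-refl {fib (suc k)})) ≈-refl ⟩
      c * fib k                        ∎
      where open ≈-Reasoning

    fib-*rank-+ : ∀ j k → fib (j * a + k) ≈ c ^ j * fib k
    fib-*rank-+ zero    k = ≈-reflexive (sym (*-identityˡ (fib k)))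
    fib-*rank-+ (suc j) k = begin
      fib (a + j * a + k)      ≡⟨ cong fib (+-assoc a (j * a) k) ⟩
      fib (a + (j * a + k))    ≈⟨ fib-rank-+ (j * a + k) ⟩
      c * fib (j * a + k)      ≈⟨ *-cong (≈-refl {c}) (fib-*rank-+ j k) ⟩
      c * (c ^ j * fib k)      ≡⟨ *-assoc c (c ^ j) (fib k) ⟨
      c ^ suc j * fib k        ∎
      where open ≈-Reasoning

    coprime-rank : Coprime d c
    coprime-rank (i∣d , i∣c) = coprime-fib-suc a′ (i∣c , ∣-trans i∣d ∣fib-rank)

    ∣fib-*rank : ∀ j → d ∣ fib (j * a)
    ∣fib-*rank j = ≈0⇒∣ (begin
      fib (j * a)        ≡⟨ cong fib (+-identityʳ (j * a)) ⟨
      fib (j * a + 0)    ≈⟨ fib-*rank-+ j 0 ⟩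
      c ^ j * 0          ≡⟨ *-zeroʳ (c ^ j) ⟩
      0                  ∎)
      where open ≈-Reasoning

    ∣fib-*rank-+⇒∣fib : ∀ j {r} → d ∣ fib (j * a + r) → d ∣ fib r
    ∣fib-*rank-+⇒∣fib j {r} d∣F = coprime-^-divisor coprime-rank j (≈-∣ (fib-*rank-+ j r) d∣F)

    ∣fib⇒rank∣ : ∀ {n} → d ∣ fib n → a ∣ n
    ∣fib⇒rank∣ {n} d∣Fn = m%n≡0⇒n∣m n a (rank-least (m%n<n n a) (∣fib-*rank-+⇒∣fib (n / a) d∣F))
      where
      d∣F : d ∣ fib (n / a * a + n % a)
      d∣F = subst (λ k → d ∣ fib k) (trans (m≡m%n+[m/n]*n n a) (+-comm (n % a) (n / a * a))) d∣Fn

    period⇒rank∣ : ∀ {q} → IsPeriod d q → a ∣ q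
    period⇒rank∣ period = ∣fib⇒rank∣ (period⇒∣fib period)

    period⇒c^≈1 : ∀ j → IsPeriod d (j * a) → c ^ j ≈ 1
    period⇒c^≈1 j (_ , periodic) = begin
      c ^ j              ≡⟨ *-identityʳ (c ^ j) ⟨
      c ^ j * fib 1      ≈⟨ fib-*rank-+ j 1 ⟨
      fib (j * a + 1)    ≡⟨ cong fib (+-comm (j * a) 1) ⟩
      fib (1 + j * a)    ≈⟨ mod-≡ (periodic 1) ⟩
      1                  ∎
      where open ≈-Reasoning

    c^≈1⇒period : ∀ {j} → 0 < j → c ^ j ≈ 1 → IsPeriod d (j * a)
    c^≈1⇒period {suc j} _ c^j≈1 = s≤s z≤n , λ n → %-≡ (begin
      fib (n + suc j * a)    ≡⟨ cong fib (+-comm n (suc j * a)) ⟩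
      fib (suc j * a + n)    ≈⟨ fib-*rank-+ (suc j) n ⟩
      c ^ suc j * fib n      ≈⟨ *-cong c^j≈1 (≈-refl {fib n}) ⟩
      1 * fib n              ≡⟨ *-identityˡ (fib n) ⟩
      fib n                  ∎)
      where open ≈-Reasoning

    zeroCount-*rank : ∀ j → zeroCount d (j * a) ≡ j
    zeroCount-*rank zero    = refl
    zeroCount-*rank (suc j) = begin
      zeroCount d (a + j * a)          ≡⟨ cong (zeroCount d) (trans (+-comm a (j * a)) (+-suc (j * a) a′)) ⟩
      zeroCount d (suc (j * a + a′))   ≡⟨ zeroCount-within-block (n<1+n a′) ⟩
      suc (zeroCount d (j * a))        ≡⟨ cong suc (zeroCount-*rank j) ⟩
      suc j                            ∎
      where
      open ≡-Reasoning
      zeroCount-within-block : ∀ {t} → t < a →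
                               zeroCount d (suc (j * a + t)) ≡ suc (zeroCount d (j * a))
      zeroCount-within-block {zero} _ rewrite +-identityʳ (j * a) = zeroCount-suc-∣ (∣fib-*rank j)
      zeroCount-within-block {suc t} t+1<a = begin
        zeroCount d (suc (j * a + suc t))  ≡⟨ zeroCount-suc-∤ d∤F ⟩
        zeroCount d (j * a + suc t)        ≡⟨ cong (zeroCount d) (+-suc (j * a) t) ⟩
        zeroCount d (suc (j * a + t))      ≡⟨ zeroCount-within-block (<-trans (n<1+n t) t+1<a) ⟩
        suc (zeroCount d (j * a))          ∎
        where
        d∤F : ¬ d ∣ fib (j * a + suc t)
        d∤F d∣F = 0≢1+n (sym (rank-least t+1<a (∣fib-*rank-+⇒∣fib j d∣F)))

    omega≡order : ∀ {j} → 0 < j → c ^ j ≈ 1 → (∀ {i} → 0 < i → c ^ i ≈ 1 → j ≤ i) →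
                  Omega d j
    omega≡order {j} 0<j c^j≈1 order-least = j * a , (c^≈1⇒period 0<j c^j≈1 , least) , zeroCount-*rank j
      where
      least : ∀ q → IsPeriod d q → j * a ≤ q
      least q period with divides i refl ← period⇒rank∣ period =
        *-monoˡ-≤ a (order-least (*-cancelʳ-< a 0 i (proj₁ period)) (period⇒c^≈1 i period))

    zeroCount≤order : ∀ {j p} → 0 < j → c ^ j ≈ 1 → IsPisano d p → zeroCount d p ≤ j
    zeroCount≤order {j} 0<j c^j≈1 (period , least) with divides i refl ← period⇒rank∣ period =
      subst (_≤ j) (sym (zeroCount-*rank i))
            (*-cancelʳ-≤ i j a (least (j * a) (c^≈1⇒period 0<j c^j≈1)))

    fib-suc-rank≈c : fib (suc a) ≈ c
    fib-suc-rank≈c = +-cong fib-rank≈0 (≈-refl {c})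

    even-rank⇒c²≈1 : 2 ∣ a → c * c ≈ 1
    even-rank⇒c²≈1 (divides (suc k) a≡) = begin
      c * c              ≈⟨ *-cong (≈-refl {c}) fib-suc-rank≈c ⟨
      c * fib (suc a)    ≡⟨ subst (λ n → fib n * fib (2 + n) ≡ fib (1 + n) * fib (1 + n) + 1)
                                  (sym (suc-injective a≡)) (cassini-odd k) ⟩
      fib a * fib a + 1  ≈⟨ +-cong (*-cong fib-rank≈0 (≈-refl {fib a})) (≈-refl {1}) ⟩
      1                  ∎
      where open ≈-Reasoning

    odd-rank⇒c²+1≈0 : ¬ 2 ∣ a → c * c + 1 ≈ 0
    odd-rank⇒c²+1≈0 ¬2∣a with even-or-odd a′
    ... | inj₂ (k , a′≡2k+1) = contradiction (divides (suc k) (cong suc a′≡2k+1)) ¬2∣a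
    ... | inj₁ (k , a′≡2k)   = begin
      c * c + 1            ≈⟨ +-cong (*-cong (≈-refl {c}) fib-suc-rank≈c) (≈-refl {1}) ⟨
      c * fib (suc a) + 1  ≡⟨ subst (λ n → fib n * fib (2 + n) + 1 ≡ fib (1 + n) * fib (1 + n))
                                    (sym a′≡2k) (cassini-even k) ⟩
      fib a * fib a        ≈⟨ *-cong fib-rank≈0 (≈-refl {fib a}) ⟩
      0                    ∎
      where open ≈-Reasoning

  even-rank⇒zeroCount≤2 : ∀ {a′ p} → IsRank (suc a′) → 2 ∣ suc a′ → IsPisano d p →
                          zeroCount d p ≤ 2
  even-rank⇒zeroCount≤2 rank 2∣a = zeroCount≤order (s≤s z≤n) c²≈1
    where
    open Rank rank
    c²≈1 : c ^ 2 ≈ 1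
    c²≈1 = ≈-trans (≈-reflexive (cong (c *_) (*-identityʳ c))) (even-rank⇒c²≈1 2∣a)

  odd-rank⇒omega4 : ∀ {a′} → IsRank (suc a′) → ¬ 2 ∣ suc a′ → 2 < d → Omega d 4
  odd-rank⇒omega4 rank ¬2∣a 2<d = omega≡order (s≤s z≤n) c⁴≈1 4≤order
    where
    open Rank rank
    open ≈-Reasoning
    c²+1≈0 : c * c + 1 ≈ 0
    c²+1≈0 = odd-rank⇒c²+1≈0 ¬2∣a
    c²≉1 : ¬ c * c ≈ 1
    c²≉1 c²≈1 = <⇒≱ 2<d (∣⇒≤ (≈0⇒∣ (begin
      1 + 1      ≈⟨ +-cong c²≈1 (≈-refl {1}) ⟨
      c * c + 1  ≈⟨ c²+1≈0 ⟩
      0          ∎)))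
    c≉1 : ¬ c ≈ 1
    c≉1 c≈1 = c²≉1 (*-cong c≈1 c≈1)
    c⁴≈1 : c ^ 4 ≈ 1
    c⁴≈1 = ≈-trans (≈-reflexive (regroup c)) (square≈1 c²+1≈0)
      where
      regroup : ∀ x → x * (x * (x * (x * 1))) ≡ (x * x) * (x * x)
      regroup = solve-∀
    4≤order : ∀ {i} → 0 < i → c ^ i ≈ 1 → 4 ≤ i
    4≤order {1} _ c¹≈1 = contradiction (≈-trans (≈-reflexive (sym (*-identityʳ c))) c¹≈1) c≉1
    4≤order {2} _ c²≈1 =
      contradiction (≈-trans (≈-reflexive (cong (c *_) (sym (*-identityʳ c)))) c²≈1) c²≉1
    4≤order {3} _ c³≈1 = contradiction (begin
      c              ≡⟨ *-identityʳ c ⟨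
      c * 1          ≈⟨ *-cong (≈-refl {c}) c³≈1 ⟨
      c ^ 4          ≈⟨ c⁴≈1 ⟩
      1              ∎) c≉1
    4≤order {suc (suc (suc (suc i)))} _ _ = s≤s (s≤s (s≤s (s≤s z≤n)))

  omega4⇒odd-rank : Omega d 4 → ∃ λ a′ → IsRank (suc a′) × ¬ 2 ∣ suc a′
  omega4⇒odd-rank (_ , pisano@(period , _) , zeroCount≡4)
    with a′ , rank ← rank-exists (proj₁ period) (period⇒∣fib period)
    = a′ , rank , λ 2∣a →
        from-no (4 ≤? 2) (subst (_≤ 2) zeroCount≡4 (even-rank⇒zeroCount≤2 rank 2∣a pisano))

∣⇒rank∣ : ∀ {d e a′ b′} .{{_ : NonZero d}} .{{_ : NonZero e}} →
          e ∣ d → IsRank e (suc b′) → IsRank d (suc a′) → suc b′ ∣ suc a′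
∣⇒rank∣ {e = e} e∣d rank-e rank-d = Rank.∣fib⇒rank∣ e rank-e (∣-trans e∣d (IsRank.∣fib-rank rank-d))

rank-four : IsRank 4 6
rank-four = record { ∣fib-rank = divides 2 refl ; rank-least = least }
  where
  least : ∀ {r} → r < 6 → 4 ∣ fib r → r ≡ 0
  least {0} _ _ = refl
  least {1} _ 4∣F = contradiction 4∣F (from-no (4 ∣? 1))
  least {2} _ 4∣F = contradiction 4∣F (from-no (4 ∣? 1))
  least {3} _ 4∣F = contradiction 4∣F (from-no (4 ∣? 2))
  least {4} _ 4∣F = contradiction 4∣F (from-no (4 ∣? 3))
  least {5} _ 4∣F = contradiction 4∣F (from-no (4 ∣? 5))
  least {suc (suc (suc (suc (suc (suc _)))))} (s≤s (s≤s (s≤s (s≤s (s≤s (s≤s ())))))) _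

omega4⇒omega4-odd-divisors : ∀ m .{{_ : NonZero m}} → Omega m 4 →
  ∀ d .{{_ : NonZero d}} → 1 < d → ¬ 2 ∣ d → d ∣ m → Omega d 4
omega4⇒omega4-odd-divisors m ω d 1<d ¬2∣d d∣m
  with a′ , rank-m , ¬2∣a ← omega4⇒odd-rank m ω
  with b′ , rank-d ← rank-exists d {suc a′} (s≤s z≤n) (∣-trans d∣m (IsRank.∣fib-rank rank-m))
  = odd-rank⇒omega4 d rank-d (λ 2∣b → ¬2∣a (∣-trans 2∣b (∣⇒rank∣ d∣m rank-d rank-m)))
                            (≤∧≢⇒< 1<d (¬2∣d ∘ ∣-reflexive))

omega4⇒4∤ : ∀ m .{{_ : NonZero m}} → Omega m 4 → ¬ 4 ∣ m
omega4⇒4∤ m ω 4∣m with a′ , rank-m , ¬2∣a ← omega4⇒odd-rank m ω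
  = ¬2∣a (∣-trans (divides 3 refl) (∣⇒rank∣ 4∣m rank-four rank-m))

theorem2p10 : (m : ℕ) → .{{_ : NonZero m}} → 2 ≤ m → Omega m 4 →
    (¬ (2 ∣ m) × (∀ d → .{{_ : NonZero d}} → 1 < d → d ∣ m → Omega d 4))
    ⊎ Σ ℕ (λ n → m ≡ 2 * n × ¬ (2 ∣ n) × (∀ d → .{{_ : NonZero d}} → 1 < d → d ∣ n → Omega d 4))
theorem2p10 m _ ω with 2 ∣? m
... | no ¬2∣m = inj₁ (¬2∣m , λ d 1<d d∣m →
        omega4⇒omega4-odd-divisors m ω d 1<d (λ 2∣d → ¬2∣m (∣-trans 2∣d d∣m)) d∣m)
... | yes (divides n m≡n*2) = inj₂ (n , m≡2n , ¬2∣n , λ d 1<d d∣n →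
        omega4⇒omega4-odd-divisors m ω d 1<d (λ 2∣d → ¬2∣n (∣-trans 2∣d d∣n))
                                   (∣-trans d∣n (divides 2 m≡2n)))
  where
  m≡2n : m ≡ 2 * n
  m≡2n = trans m≡n*2 (*-comm n 2)
  ¬2∣n : ¬ 2 ∣ n
  ¬2∣n 2∣n = omega4⇒4∤ m ω (subst (4 ∣_) (sym m≡n*2) (*-monoˡ-∣ 2 2∣n))
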